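{- Let $G=(V,E)$ be a finite $r$-regular graph and let $S\subset V$. Suppose that every vertex $x\in S$ has $a(x)\leq a$ neighbors in $S$, and every vertex $y\in V\setminus S$ has $d(y)\geq d$ neighbors in $V\setminus S$. Then $$\frac{|S|}{|V|}\leq \frac{r-d}{2r-a-d}.$$ If $\frac{|S|}{|V|}=\frac{r-d}{2r-a-d}$, then ${\bf 1}_S$ is a perfect $2$-coloring with quotient matrix $\begin{pmatrix} a & r-a\\ r-d & d\end{pmatrix}$.
   Context: A function $f:V\to I$ is a perfect coloring of $G$ if there are integers $q_{ij}$ ($i,j\in I$) such that every vertex of $f^{ -1}(i)$ is adjacent to exactly $q_{ij}$ vertices of $f^{ -1}(j)$; the matrix $Q=(q_{ij})$ is its quotient matrix, and the partition $\{f^{ -1}(i)\}$ is called an equitable partition. Saying ${\bf 1}_S$ (the indicator function of $S$) is a perfect $2$-coloring with quotient matrix $Q$ means the partition $\{S, V\setminus S\}$ is equitable, with the first row/column corresponding to $S$. -}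

module Defs where

open import Data.Nat using (ℕ; zero; suc; _+_)
open import Data.Fin using (Fin; zero; suc)
open import Data.Bool using (Bool; true; false; _∧_; not; if_then_else_)
open import Relation.Binary.PropositionalEquality using (_≡_)

count : {n : ℕ} → (Fin n → Bool) → ℕ
count {zero} P = 0
count {suc n} P = (if P zero then 1 else 0) + count (λ i → P (suc i))

record Graph (n : ℕ) : Set where
  field
    adj   : Fin n → Fin n → Bool
    sym   : ∀ x y → adj x y ≡ adj y x
    irrefl : ∀ x → adj x x ≡ false

open Graph public

degIn : {n : ℕ} → Graph n → (Fin n → Bool) → Fin n → ℕ
degIn G T x = count (λ y → adj G x y ∧ T y)

deg : {n : ℕ} → Graph n → Fin n → ℕ
deg G x = count (λ y → adj G x y)

Regular : {n : ℕ} → Graph n → ℕ → Set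
Regular G r = ∀ x → deg G x ≡ r

compl : {n : ℕ} → (Fin n → Bool) → (Fin n → Bool)
compl S x = not (S x)

PerfectTwoColoring : {n : ℕ} → Graph n → (Fin n → Bool) → ℕ → ℕ → ℕ → ℕ → Set
PerfectTwoColoring G S q11 q12 q21 q22 =
  (∀ x → S x ≡ true → degIn G S x ≡ q11 × degIn G (compl S) x ≡ q12) ×
  (∀ y → S y ≡ false → degIn G S y ≡ q21 × degIn G (compl S) y ≡ q22)
  where open import Data.Product using (_×_)

{-# OPTIONS --safe #-}
-- Double counting the edges between S and its complement: each x ∈ S sends
-- at least r − a of them, each y ∉ S receives at most r − d, so
-- |S| (r − a) ≤ |V ∖ S| (r − d), which rearranges to the bound. In the case
-- of equality both estimates are tight, so they are tight at every vertex.
module Submission where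

open import Defs hiding (sym)
import Algebra.Properties.Semiring.Sum as Sum
open import Data.Bool using (Bool; true; false; _∧_; not; if_then_else_)
open import Data.Bool.Properties using (∧-assoc; ∧-comm; not-injective)
open import Data.Fin using (Fin; zero; suc)
open import Data.Nat using (ℕ; zero; suc; _+_; _*_; _∸_; _≤_; _<_; z≤n)
open import Data.Nat.Properties
open import Data.Nat.Solver using (module +-*-Solver)
open import Data.Product using (_×_; _,_)
open import Function using (_∘_)
open import Relation.Binary.PropositionalEquality

open Sum +-*-semiring using (sum-syntax; *-distribˡ-sum; *-distribʳ-sum; ∑-comm; sum-cong-≗)

∑-mono-≤ : ∀ {n} {f g : Fin n → ℕ} → (∀ i → f i ≤ g i) → ∑[ i < n ] f i ≤ ∑[ i < n ] g i
∑-mono-≤ {zero}  f≤g = z≤n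
∑-mono-≤ {suc n} f≤g = +-mono-≤ (f≤g zero) (∑-mono-≤ (f≤g ∘ suc))

∑-mono-≤-tight : ∀ {n} {f g : Fin n → ℕ} → (∀ i → f i ≤ g i) →
                 ∑[ i < n ] g i ≤ ∑[ i < n ] f i → ∀ i → f i ≡ g i
∑-mono-≤-tight {suc n} {f} {g} f≤g ∑g≤∑f zero = ≤-antisym (f≤g zero)
  (+-cancelʳ-≤ _ (g zero) (f zero)
    (≤-trans (+-monoʳ-≤ (g zero) (∑-mono-≤ (f≤g ∘ suc))) ∑g≤∑f))
∑-mono-≤-tight {suc n} {f} {g} f≤g ∑g≤∑f (suc i) = ∑-mono-≤-tight (f≤g ∘ suc)
  (+-cancelˡ-≤ (g zero) _ _ (≤-trans ∑g≤∑f (+-monoˡ-≤ _ (f≤g zero)))) i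

χ : Bool → ℕ
χ b = if b then 1 else 0

sumOver : ∀ {n} → (Fin n → Bool) → (Fin n → ℕ) → ℕ
sumOver {n} P f = ∑[ x < n ] (χ (P x) * f x)

χ-*-monoʳ-≤ : ∀ b {m n} → (b ≡ true → m ≤ n) → χ b * m ≤ χ b * n
χ-*-monoʳ-≤ true  m≤n = *-monoʳ-≤ 1 (m≤n refl)
χ-*-monoʳ-≤ false m≤n = z≤n

χ-*-cancelˡ-≡ : ∀ {b m n} → b ≡ true → χ b * m ≡ χ b * n → m ≡ n
χ-*-cancelˡ-≡ refl = *-cancelˡ-≡ _ _ 1

count-true : ∀ n → count {n} (λ _ → true) ≡ n
count-true zero    = refl
count-true (suc n) = cong suc (count-true n)

count≡∑χ : ∀ {n} (P : Fin n → Bool) → count P ≡ ∑[ x < n ] χ (P x)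
count≡∑χ {zero}  P = refl
count≡∑χ {suc n} P = cong (χ (P zero) +_) (count≡∑χ (P ∘ suc))

sumOver-const : ∀ {n} (P : Fin n → Bool) k → sumOver P (λ _ → k) ≡ count P * k
sumOver-const P k = begin
  sumOver P (λ _ → k)  ≡⟨ *-distribʳ-sum k (χ ∘ P) ⟨
  (∑[ x < _ ] χ (P x)) * k ≡⟨ cong (_* k) (count≡∑χ P) ⟨
  count P * k          ∎
  where open ≡-Reasoning

module _ {n} (P : Fin n → Bool) {f g : Fin n → ℕ}
         (f≤g : ∀ x → P x ≡ true → f x ≤ g x) where

  sumOver-mono-≤ : sumOver P f ≤ sumOver P g
  sumOver-mono-≤ = ∑-mono-≤ (λ x → χ-*-monoʳ-≤ (P x) (f≤g x))

  sumOver-mono-≤-tight : sumOver P g ≤ sumOver P f → ∀ x → P x ≡ true → f x ≡ g x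
  sumOver-mono-≤-tight ∑g≤∑f x Px =
    χ-*-cancelˡ-≡ Px (∑-mono-≤-tight (λ y → χ-*-monoʳ-≤ (P y) (f≤g y)) ∑g≤∑f x)

count-∧-split : ∀ {n} (P T : Fin n → Bool) →
                count (λ y → P y ∧ T y) + count (λ y → P y ∧ not (T y)) ≡ count P
count-∧-split {zero}  P T = refl
count-∧-split {suc n} P T with P zero | T zero
... | true  | true  = cong suc (count-∧-split (P ∘ suc) (T ∘ suc))
... | true  | false = trans (+-suc _ _) (cong suc (count-∧-split (P ∘ suc) (T ∘ suc)))
... | false | _     = count-∧-split (P ∘ suc) (T ∘ suc)

χ-*-count : ∀ {n} b (P : Fin n → Bool) → χ b * count P ≡ ∑[ i < n ] χ (b ∧ P i)
χ-*-count b P = trans (cong (χ b *_) (count≡∑χ P)) (trans (*-distribˡ-sum (χ b) (χ ∘ P))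
  (sum-cong-≗ (λ i → χ-*-χ b (P i))))
  where
  χ-*-χ : ∀ b c → χ b * χ c ≡ χ (b ∧ c)
  χ-*-χ true  c = *-identityˡ (χ c)
  χ-*-χ false c = refl

cut : ∀ {n} → Graph n → (Fin n → Bool) → (Fin n → Bool) → ℕ
cut G S T = sumOver S (degIn G T)

cut-sym : ∀ {n} (G : Graph n) (S T : Fin n → Bool) → cut G S T ≡ cut G T S
cut-sym {n} G S T = begin
  cut G S T                                       ≡⟨ sum-cong-≗ (λ x → χ-*-count (S x) (λ y → adj G x y ∧ T y)) ⟩
  ∑[ x < n ] ∑[ y < n ] χ (S x ∧ (adj G x y ∧ T y)) ≡⟨ ∑-comm (λ x y → χ (S x ∧ (adj G x y ∧ T y))) ⟩
  ∑[ y < n ] ∑[ x < n ] χ (S x ∧ (adj G x y ∧ T y)) ≡⟨ sum-cong-≗ (λ y → sum-cong-≗ (λ x → cong χ (edge-flip x y))) ⟩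
  ∑[ y < n ] ∑[ x < n ] χ (T y ∧ (adj G y x ∧ S x)) ≡⟨ sum-cong-≗ (λ y → χ-*-count (T y) (λ x → adj G y x ∧ S x)) ⟨
  cut G T S                                       ∎
  where
  open ≡-Reasoning
  edge-flip : ∀ x y → S x ∧ (adj G x y ∧ T y) ≡ T y ∧ (adj G y x ∧ S x)
  edge-flip x y = begin
    S x ∧ (adj G x y ∧ T y)  ≡⟨ cong (λ e → S x ∧ (e ∧ T y)) (Graph.sym G x y) ⟩
    S x ∧ (adj G y x ∧ T y)  ≡⟨ ∧-comm (S x) _ ⟩
    (adj G y x ∧ T y) ∧ S x  ≡⟨ cong (_∧ S x) (∧-comm (adj G y x) (T y)) ⟩
    (T y ∧ adj G y x) ∧ S x  ≡⟨ ∧-assoc (T y) _ _ ⟩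
    T y ∧ (adj G y x ∧ S x)  ∎

module _ {n r} (G : Graph n) (regular : Regular G r) (S : Fin n → Bool) (x : Fin n) where

  degIn-+-compl : degIn G S x + degIn G (compl S) x ≡ r
  degIn-+-compl = trans (count-∧-split (adj G x) S) (regular x)

  degIn-compl≡r∸degIn : degIn G (compl S) x ≡ r ∸ degIn G S x
  degIn-compl≡r∸degIn = trans (sym (m+n∸m≡n (degIn G S x) _)) (cong (_∸ degIn G S x) degIn-+-compl)

  degIn≡r∸degIn-compl : degIn G S x ≡ r ∸ degIn G (compl S) x
  degIn≡r∸degIn-compl = trans (sym (m+n∸n≡m _ (degIn G (compl S) x))) (cong (_∸ degIn G (compl S) x) degIn-+-compl)

module CutBounds {n r a d} (G : Graph n) (regular : Regular G r) (S : Fin n → Bool)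
         (inS : ∀ x → S x ≡ true → degIn G S x ≤ a)
         (outS : ∀ y → S y ≡ false → d ≤ degIn G (compl S) y) where

  private
    leaves : ∀ x → S x ≡ true → r ∸ a ≤ degIn G (compl S) x
    leaves x Sx = subst (r ∸ a ≤_) (sym (degIn-compl≡r∸degIn G regular S x)) (∸-monoʳ-≤ r (inS x Sx))

    enters : ∀ y → compl S y ≡ true → degIn G S y ≤ r ∸ d
    enters y ¬Sy = subst (_≤ r ∸ d) (sym (degIn≡r∸degIn-compl G regular S y))
      (∸-monoʳ-≤ r (outS y (not-injective ¬Sy)))

  count*≤cut : count S * (r ∸ a) ≤ cut G S (compl S)
  count*≤cut = subst (_≤ cut G S (compl S)) (sumOver-const S (r ∸ a)) (sumOver-mono-≤ S leaves)

  cut≤count* : cut G S (compl S) ≤ count (compl S) * (r ∸ d)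
  cut≤count* = subst₂ _≤_ (cut-sym G (compl S) S) (sumOver-const (compl S) (r ∸ d))
    (sumOver-mono-≤ (compl S) enters)

  count*≤cut-tight : a ≤ r → cut G S (compl S) ≤ count S * (r ∸ a) →
                     ∀ x → S x ≡ true → degIn G S x ≡ a × degIn G (compl S) x ≡ r ∸ a
  count*≤cut-tight a≤r cut≤ x Sx = degS , sym degC
    where
    degC : r ∸ a ≡ degIn G (compl S) x
    degC = sumOver-mono-≤-tight S leaves
      (≤-trans cut≤ (≤-reflexive (sym (sumOver-const S (r ∸ a))))) x Sx
    degS : degIn G S x ≡ a
    degS = trans (degIn≡r∸degIn-compl G regular S x) (trans (cong (r ∸_) (sym degC)) (m∸[m∸n]≡n a≤r))

  cut≤count*-tight : d ≤ r → count (compl S) * (r ∸ d) ≤ cut G S (compl S) →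
                     ∀ y → S y ≡ false → degIn G S y ≡ r ∸ d × degIn G (compl S) y ≡ d
  cut≤count*-tight d≤r ≤cut y ¬Sy = degS , degC
    where
    degS : degIn G S y ≡ r ∸ d
    degS = sumOver-mono-≤-tight (compl S) enters
      (subst₂ _≤_ (sym (sumOver-const (compl S) (r ∸ d))) (cut-sym G S (compl S)) ≤cut)
      y (cong not ¬Sy)
    degC : degIn G (compl S) y ≡ d
    degC = trans (degIn-compl≡r∸degIn G regular S y) (trans (cong (r ∸_) degS) (m∸[m∸n]≡n d≤r))

[m+m]∸[n+o]≡[m∸n]+[m∸o] : ∀ {m n o} → n ≤ m → o ≤ m → (m + m) ∸ (n + o) ≡ (m ∸ n) + (m ∸ o)
[m+m]∸[n+o]≡[m∸n]+[m∸o] {m} {n} {o} n≤m o≤m = begin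
  (m + m) ∸ (n + o)    ≡⟨ ∸-+-assoc (m + m) n o ⟨
  (m + m) ∸ n ∸ o      ≡⟨ cong (_∸ o) (+-∸-comm m n≤m) ⟩
  ((m ∸ n) + m) ∸ o    ≡⟨ +-∸-assoc (m ∸ n) o≤m ⟩
  (m ∸ n) + (m ∸ o)    ∎
  where open ≡-Reasoning

module _ (s m p q : ℕ) where

  private
    regroup : s * (p + q) + m * q ≡ s * p + q * (s + m)
    regroup = solve 4 (λ s m p q → s :* (p :+ q) :+ m :* q := s :* p :+ q :* (s :+ m)) refl s m p q
      where open +-*-Solver

  balance⇒bound : s * p ≤ m * q → s * (p + q) ≤ q * (s + m)
  balance⇒bound sp≤mq = +-cancelʳ-≤ (m * q) _ _
    (≤-trans (≤-reflexive regroup) (≤-trans (+-monoˡ-≤ _ sp≤mq) (≤-reflexive (+-comm (m * q) _))))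

  bound-tight⇒balance : s * (p + q) ≡ q * (s + m) → s * p ≡ m * q
  bound-tight⇒balance tight = +-cancelʳ-≡ (q * (s + m)) _ _
    (trans (sym regroup) (trans (cong (_+ m * q) tight) (+-comm _ (m * q))))

proposition3 : (n r a d : ℕ) (G : Graph n) → Regular G r →
    a ≤ r → d ≤ r → a + d < r + r →
    (S : Fin n → Bool) →
    (∀ x → S x ≡ true → degIn G S x ≤ a) →
    (∀ y → S y ≡ false → d ≤ degIn G (compl S) y) →
    (count S * ((r + r) ∸ (a + d)) ≤ (r ∸ d) * n)
    × (count S * ((r + r) ∸ (a + d)) ≡ (r ∸ d) * n →
    PerfectTwoColoring G S a (r ∸ a) (r ∸ d) d)
proposition3 n r a d G regular a≤r d≤r _ S inS outS = bound , tightness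
  where
  open CutBounds G regular S inS outS
  s = count S
  m = count (compl S)

  s+m≡n : s + m ≡ n
  s+m≡n = trans (count-∧-split (λ _ → true) S) (count-true n)

  total : s * ((r + r) ∸ (a + d)) ≡ s * ((r ∸ a) + (r ∸ d))
  total = cong (s *_) ([m+m]∸[n+o]≡[m∸n]+[m∸o] a≤r d≤r)

  bound : s * ((r + r) ∸ (a + d)) ≤ (r ∸ d) * n
  bound = subst₂ _≤_ (sym total) (cong ((r ∸ d) *_) s+m≡n)
    (balance⇒bound s m (r ∸ a) (r ∸ d) (≤-trans count*≤cut cut≤count*))

  tightness : s * ((r + r) ∸ (a + d)) ≡ (r ∸ d) * n → PerfectTwoColoring G S a (r ∸ a) (r ∸ d) d
  tightness e = count*≤cut-tight a≤r (≤-trans cut≤count* (≤-reflexive (sym balanced)))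
              , cut≤count*-tight d≤r (≤-trans (≤-reflexive (sym balanced)) count*≤cut)
    where
    balanced : s * (r ∸ a) ≡ m * (r ∸ d)
    balanced = bound-tight⇒balance s m (r ∸ a) (r ∸ d)
      (trans (sym total) (trans e (cong ((r ∸ d) *_) (sym s+m≡n))))
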